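{- For all positive integers $\chi \geq 3$ and $n$, every ordered $3$-uniform hypergraph $\mathcal{H}$ on $n$ vertices with interval chromatic number $\chi$ satisfies \[\overline{R}(\mathcal{H}) \leq 2^{2^{2R}\chi^2 n^2},\] where $R = R(K_{\chi-1})$ is the (usual, unordered) two-color Ramsey number of the complete graph on $\chi-1$ vertices. In particular, if $\chi$ is fixed, $\overline{R}(\mathcal{H}) \leq 2^{O(n^2)}$.
   Context: An ordered $k$-uniform hypergraph is a $k$-uniform hypergraph together with a linear ordering of its vertex set; ordered subhypergraphs and isomorphisms must respect the orderings. $\mathcal{K}^{(k)}_N$ is the ordered complete $k$-uniform hypergraph on $N$ vertices. $\overline{R}(\mathcal{H})$ is the smallest $N$ such that every red-blue coloring of the hyperedges of $\mathcal{K}^{(k)}_N$ contains a monochromatic ordered subhypergraph isomorphic to $\mathcal{H}$ (with the same ordering). An interval is a set $I$ of vertices such that $u<v<w$ and $u,w\in I$ imply $v \in I$. The interval chromatic number of an ordered hypergraph is the minimum number of intervals into which the vertex set can be partitioned so that every hyperedge has at most one vertex in each interval. -}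

module Defs where

open import Data.Nat using (ℕ; _≤_)
open import Data.Fin using (Fin) renaming (_<_ to _<ᶠ_; _≤_ to _≤ᶠ_)
open import Data.Bool using (Bool; true)
open import Data.Product using (Σ; _×_; ∃; ∃-syntax)
open import Relation.Binary.PropositionalEquality using (_≡_)

-- An ordered 3-uniform hypergraph on the vertex set Fin n (ordered by the
-- natural order of Fin n).  Its hyperedges are the triples {i,j,k} with
-- i < j < k and  edge i j k ≡ true ; values on non-increasing triples are ignored.
OHG3 : ℕ → Set
OHG3 n = Fin n → Fin n → Fin n → Bool

-- A red/blue colouring of the hyperedges of the ordered complete 3-graph K^(3)_N:
-- the colour of {i<j<k} is  c i j k  (values on non-increasing triples are ignored).
Colouring3 : ℕ → Set
Colouring3 N = Fin N → Fin N → Fin N → Bool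

StrictlyIncreasing : ∀ {m N} → (Fin m → Fin N) → Set
StrictlyIncreasing f = ∀ i j → i <ᶠ j → f i <ᶠ f j

HasMonoCopy : ∀ {n N} → OHG3 n → Colouring3 N → Set
HasMonoCopy {n} {N} H c =
  Σ (Fin n → Fin N) λ f → StrictlyIncreasing f × ∃[ b ]
    (∀ i j k → i <ᶠ j → j <ᶠ k → H i j k ≡ true → c (f i) (f j) (f k) ≡ b)

OrdArrows : ∀ {n} → ℕ → OHG3 n → Set
OrdArrows N H = (c : Colouring3 N) → HasMonoCopy H c

-- \overline{R}(H) ≤ M  (the least N with K^(3)_N → H exists and is ≤ M)
OrdRamseyLE : ∀ {n} → OHG3 n → ℕ → Set
OrdRamseyLE H M = ∃[ N ] (N ≤ M × OrdArrows N H)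

-- A partition of Fin n into exactly m (nonempty) intervals, given by the map g
-- sending a vertex to the index of its interval: g is monotone (so the parts are
-- intervals, listed left to right) and surjective (so all m parts are nonempty),
-- and every hyperedge has its three vertices in three distinct intervals.
IntervalPartition : ∀ {n} → OHG3 n → ℕ → Set
IntervalPartition {n} H m =
  Σ (Fin n → Fin m) λ g →
      (∀ i j → i ≤ᶠ j → g i ≤ᶠ g j)
    × (∀ p → ∃[ i ] g i ≡ p)
    × (∀ i j k → i <ᶠ j → j <ᶠ k → H i j k ≡ true → g i <ᶠ g j × g j <ᶠ g k)

IntervalChromaticNumber : ∀ {n} → OHG3 n → ℕ → Set
IntervalChromaticNumber H χ =
  IntervalPartition H χ × (∀ m → IntervalPartition H m → χ ≤ m)

GraphColouring : ℕ → Set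
GraphColouring N = Fin N → Fin N → Bool

GraphArrows : ℕ → ℕ → Set
GraphArrows N k = (c : GraphColouring N) →
  Σ (Fin k → Fin N) λ f → StrictlyIncreasing f × ∃[ b ]
    (∀ i j → i <ᶠ j → c (f i) (f j) ≡ b)

IsRamseyNumber : ℕ → ℕ → Set
IsRamseyNumber k R = GraphArrows R k × (∀ N → GraphArrows N k → R ≤ N)

module Submission where

open import Defs
open import Data.Nat using (ℕ; zero; suc; _+_; _*_; _^_; _∸_; _≤_; _<_; z≤n; s≤s)
open import Data.Nat.Properties
open import Data.Nat.Tactic.RingSolver using (solve-∀)
open import Data.Fin using (Fin; zero; suc; toℕ; fromℕ<; inject≤; punchOut; _↑ˡ_; _↑ʳ_; opposite)
  renaming (_<_ to _<ᶠ_; _≤_ to _≤ᶠ_; _≟_ to _≟ᶠ_)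
open import Data.Fin.Properties using (toℕ-inject≤; punchIn-punchOut; toℕ-↑ˡ; toℕ-↑ʳ; toℕ<n; opposite-prop)
  renaming (≤∧≢⇒< to ≤∧≢⇒<ᶠ)
open import Data.Bool using (Bool; true; false) renaming (_≟_ to _≟ᵇ_)
open import Data.Bool.Properties using (¬-not)
open import Data.Product using (Σ; _×_; _,_; proj₁; proj₂; ∃-syntax)
open import Data.Product.Relation.Binary.Pointwise.NonDependent using () renaming (Pointwise to _×ᴿ_)
open import Data.Sum using (_⊎_; inj₁; inj₂)
open import Data.Vec.Functional using (_∷_)
open import Data.Vec.Functional.Relation.Binary.Pointwise using (Pointwise)
import Data.Vec.Functional.Relation.Binary.Pointwise.Properties as Pointwise
open import Function using (_∘_)
open import Relation.Binary.Definitions using (Transitive)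
open import Relation.Nullary using (¬_; Dec; yes; no)
open import Relation.Binary.PropositionalEquality using (_≡_; refl; sym; trans; cong; subst; subst₂)

-- Inside any 2-colouring c of K^(3)_N we find blocks B_R < ... < B_1 < T of n vertices each
-- such that the colour of a triple meeting three different parts depends only on the parts
-- of its two smallest vertices.  The blocks are split off one at a time from the start of
-- the current tail: pigeonholing twice gives X front vertices Y and a long remainder Z of
-- the tail such that c(b, y, z) (b in an old block, y ∈ Y, z ∈ Z) depends only on b, and
-- keeping the half of each old block on which this colour is constant makes it depend only
-- on the block of b.  With t old blocks of size 2X this costs a factor 2^(O(t X²)) in the
-- tail length, which adds up to the stated bound.  Finally R(K_(χ-1)) applied to the colours
-- of pairs of blocks yields χ - 1 blocks with constant pair colour, and placing the χ
-- intervals of H into these blocks and T gives a monochromatic copy of H.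

-- Increasing selections

strictlyIncreasing-∘ : ∀ {a b c} {f : Fin b → Fin c} {g : Fin a → Fin b} →
  StrictlyIncreasing f → StrictlyIncreasing g → StrictlyIncreasing (f ∘ g)
strictlyIncreasing-∘ f-inc g-inc i j i<j = f-inc _ _ (g-inc i j i<j)

Selection : ℕ → ∀ {M} → (Fin M → Set) → Set
Selection s {M} P = Σ (Fin s → Fin M) λ e → StrictlyIncreasing e × (∀ p → P (e p))

refine : ∀ {s M M'} {Q : Fin M' → Set} {P : Fin M → Set} (f : Fin M' → Fin M) →
  StrictlyIncreasing f → (∀ z → Q z → P (f z)) → Selection s Q → Selection s P
refine f f-inc Q⇒P (e , e-inc , e-Q) = f ∘ e , strictlyIncreasing-∘ f-inc e-inc , Q⇒P _ ∘ e-Q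

weaken : ∀ {s M} {Q P : Fin M → Set} → (∀ z → Q z → P z) → Selection s Q → Selection s P
weaken = refine (λ z → z) (λ _ _ h → h)

initialSegment : ∀ {s M} → s ≤ M → Σ (Fin s → Fin M) StrictlyIncreasing
initialSegment s≤M = (λ i → inject≤ i s≤M) , λ i j →
  subst₂ _<_ (sym (toℕ-inject≤ i s≤M)) (sym (toℕ-inject≤ j s≤M))

emptySelection : ∀ {M} {P : Fin M → Set} → Selection 0 P
emptySelection = (λ ()) , (λ ()) , (λ ())

skipFirst : ∀ {s M} {P : Fin (suc M) → Set} → Selection s (P ∘ suc) → Selection s P
skipFirst {P = P} = refine {P = P} suc (λ _ _ → s≤s) (λ _ h → h)

takeFirst : ∀ {s M} {P : Fin (suc M) → Set} → P zero → Selection s (P ∘ suc) → Selection (suc s) P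
takeFirst {P = P} P0 (e , e-inc , e-P) = zero ∷ suc ∘ e , inc , P-∷
  where
  inc : StrictlyIncreasing (zero ∷ suc ∘ e)
  inc zero    (suc j) _       = s≤s z≤n
  inc (suc i) (suc j) (s≤s h) = s≤s (e-inc i j h)
  P-∷ : ∀ p → P ((zero ∷ suc ∘ e) p)
  P-∷ zero    = P0
  P-∷ (suc p) = e-P p

selection⊎complement : ∀ {M} {P : Fin M → Set} → (∀ z → Dec (P z)) →
  ∀ a b → a + b ≤ M → Selection a P ⊎ Selection b (¬_ ∘ P)
selection⊎complement {P = P} P? zero    b       _ = inj₁ (emptySelection {P = P})
selection⊎complement {P = P} P? (suc a) zero    _ = inj₂ (emptySelection {P = ¬_ ∘ P})
selection⊎complement {suc M} {P} P? (suc a) (suc b) (s≤s a+b<M) with P? zero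
... | yes P0 with selection⊎complement {P = P ∘ suc} (P? ∘ suc) a (suc b) a+b<M
...   | inj₁ sel = inj₁ (takeFirst {P = P} P0 sel)
...   | inj₂ sel = inj₂ (skipFirst {P = ¬_ ∘ P} sel)
selection⊎complement {suc M} {P} P? (suc a) (suc b) (s≤s a+b<M) | no ¬P0
  with selection⊎complement {P = P ∘ suc} (P? ∘ suc) (suc a) b (subst (_≤ M) (+-suc a b) a+b<M)
...   | inj₁ sel = inj₁ (skipFirst {P = P} sel)
...   | inj₂ sel = inj₂ (takeFirst {P = ¬_ ∘ P} ¬P0 sel)

-- Pigeonhole principles

Pigeonhole : ∀ {A : Set} → ℕ → (A → A → Set) → Set
Pigeonhole {A} K _≈_ =
  ∀ s M → K * s ≤ M → (lab : Fin M → A) → ∃[ v ] Selection s (λ z → lab z ≈ v)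

pigeonhole-trivial : ∀ {A : Set} {_≈_ : A → A → Set} v → (∀ x → x ≈ v) → Pigeonhole 1 _≈_
pigeonhole-trivial v ≈v s M s≤M lab with initialSegment {s} {M} (subst (_≤ M) (+-identityʳ s) s≤M)
... | e , e-inc = v , e , e-inc , λ p → ≈v (lab (e p))

pigeonhole-Bool : Pigeonhole 2 (_≡_ {A = Bool})
pigeonhole-Bool s M 2s≤M lab
  with selection⊎complement (λ z → lab z ≟ᵇ true) s s
         (subst (_≤ M) (cong (s +_) (+-identityʳ s)) 2s≤M)
... | inj₁ sel = true , sel
... | inj₂ sel = false , weaken {P = λ z → lab z ≡ false} (λ _ → ¬-not) sel

pigeonhole-Fin : ∀ L → Pigeonhole (suc L) (_≡_ {A = Fin (suc L)})
pigeonhole-Fin zero = pigeonhole-trivial {_≈_ = _≡_} zero λ { zero → refl }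
pigeonhole-Fin (suc L) s M s+Ls≤M lab
  with selection⊎complement (λ z → lab z ≟ᶠ zero) s (suc L * s) s+Ls≤M
... | inj₁ sel = zero , sel
... | inj₂ (e , e-inc , lab≢0)
  with pigeonhole-Fin L s (suc L * s) ≤-refl (λ q → punchOut (lab≢0 q ∘ sym))
...   | v , sel = suc v , refine {P = λ z → lab z ≡ suc v} e e-inc
          (λ q eq → trans (sym (punchIn-punchOut (lab≢0 q ∘ sym))) (cong suc eq)) sel

pigeonhole-× : ∀ {A B : Set} {R : A → A → Set} {S : B → B → Set} {K K'} →
  Pigeonhole K R → Pigeonhole K' S → Pigeonhole (K * K') (R ×ᴿ S)
pigeonhole-× {R = R} {S} {K} {K'} ph₁ ph₂ s M KK's≤M lab
  with ph₁ (K' * s) M (subst (_≤ M) (*-assoc K K' s) KK's≤M) (proj₁ ∘ lab)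
... | a , e , e-inc , e-R
  with ph₂ s (K' * s) ≤-refl (proj₂ ∘ lab ∘ e)
...   | b , sel = (a , b) , refine {P = λ z → (R ×ᴿ S) (lab z) (a , b)} e e-inc (λ q → e-R q ,_) sel

pigeonhole-Pointwise : ∀ {A : Set} {R : A → A → Set} {K} →
  Pigeonhole K R → ∀ m → Pigeonhole (K ^ m) (Pointwise R {m})
pigeonhole-Pointwise {R = R} ph zero = pigeonhole-trivial {_≈_ = Pointwise R} (λ ()) (λ _ ())
pigeonhole-Pointwise {R = R} {K} ph (suc m) s M Kᵐ⁺¹s≤M lab
  with pigeonhole-× {R = R} {Pointwise R} {K} {K ^ m} ph (pigeonhole-Pointwise {R = R} ph m)
         s M Kᵐ⁺¹s≤M (λ z → lab z zero , lab z ∘ suc)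
... | (a , v) , sel = a ∷ v , weaken {P = λ z → Pointwise R (lab z) (a ∷ v)} R-∷ sel
  where
  R-∷ : ∀ z → R (lab z zero) a × Pointwise R (lab z ∘ suc) v → Pointwise R (lab z) (a ∷ v)
  R-∷ z (r , rs) zero    = r
  R-∷ z (r , rs) (suc w) = rs w

record ConstantRectangle {A : Set} (_≈_ : A → A → Set) (X M : ℕ) {L M₀}
         (lab : Fin M₀ → Fin L → A) : Set where
  field
    value     : A
    front     : Fin X → Fin L
    front-inc : StrictlyIncreasing front
    back      : Fin M → Fin M₀
    back-inc  : StrictlyIncreasing back
    constant  : ∀ z y → lab (back z) (front y) ≈ value

bipartite-pigeonhole : ∀ {A : Set} {_≈_ : A → A → Set} {K} → Transitive _≈_ → Pigeonhole K _≈_ →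
  ∀ X L M → 0 < M → K * X ≤ suc L → (lab : Fin (K * suc L ^ X * M) → Fin (suc L) → A) →
  ConstantRectangle _≈_ X M lab
bipartite-pigeonhole {A} {_≈_} {K} ≈-trans ph X L M 0<M KX≤L lab =
  rectangle (pigeonhole-× {R = _≈_} {Pointwise _≡_} {K} {suc L ^ X} ph
              (pigeonhole-Pointwise {R = _≡_} (pigeonhole-Fin L) X) M _ ≤-refl (λ z → colour z , row z))
  where
  -- Each back vertex z gets as colour the value of lab z on a homogeneous row of X front
  -- vertices together with that row; a large class of equally coloured z is the rectangle.
  rows : ∀ z → ∃[ u ] Selection X (λ y → lab z y ≈ u)
  rows z = ph X (suc L) KX≤L (lab z)
  colour : Fin (K * suc L ^ X * M) → A
  colour z = proj₁ (rows z)
  row : Fin (K * suc L ^ X * M) → Fin X → Fin (suc L)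
  row z = proj₁ (proj₂ (rows z))
  row-inc : ∀ z → StrictlyIncreasing (row z)
  row-inc z = proj₁ (proj₂ (proj₂ (rows z)))
  row-constant : ∀ z y → lab z (row z y) ≈ colour z
  row-constant z = proj₂ (proj₂ (proj₂ (rows z)))

  rectangle : ∃[ vY ] Selection M (λ z → colour z ≈ proj₁ vY × Pointwise _≡_ (row z) (proj₂ vY)) →
    ConstantRectangle _≈_ X M lab
  rectangle ((v , Y) , Z , Z-inc , Z-same) = record
    { value = v ; front = Y ; front-inc = Y-inc ; back = Z ; back-inc = Z-inc
    ; constant = λ z y → ≈-trans
        (subst (λ q → lab (Z z) q ≈ colour (Z z)) (proj₂ (Z-same z) y) (row-constant (Z z) y))
        (proj₁ (Z-same z)) }
    where
    -- All selected z share the row Y, so any one of them shows Y is increasing; hence 0 < M.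
    z₀ : Fin M
    z₀ = fromℕ< 0<M
    Y-inc : StrictlyIncreasing Y
    Y-inc i j = subst₂ _<ᶠ_ (proj₂ (Z-same z₀) i) (proj₂ (Z-same z₀) j) ∘ row-inc (Z z₀) i j

↑ˡ-strictlyIncreasing : ∀ {m} n → StrictlyIncreasing (λ (i : Fin m) → i ↑ˡ n)
↑ˡ-strictlyIncreasing n i j = subst₂ _<_ (sym (toℕ-↑ˡ i n)) (sym (toℕ-↑ˡ j n))

↑ʳ-strictlyIncreasing : ∀ m {n} → StrictlyIncreasing (λ (i : Fin n) → m ↑ʳ i)
↑ʳ-strictlyIncreasing m i j i<j = subst₂ _<_ (sym (toℕ-↑ʳ m i)) (sym (toℕ-↑ʳ m j)) (+-monoʳ-< m i<j)

↑ˡ<↑ʳ : ∀ {m n} (i : Fin m) (j : Fin n) → i ↑ˡ n <ᶠ m ↑ʳ j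
↑ˡ<↑ʳ {m} {n} i j = subst₂ _<_ (sym (toℕ-↑ˡ i n)) (sym (toℕ-↑ʳ m j)) (<-≤-trans (toℕ<n i) (m≤m+n m (toℕ j)))

opposite-reverses-≤ : ∀ {n} {i j : Fin n} → i ≤ᶠ j → opposite j ≤ᶠ opposite i
opposite-reverses-≤ {n} {i} {j} i≤j = subst₂ _≤_ (sym (opposite-prop j)) (sym (opposite-prop i))
  (∸-monoʳ-≤ n (s≤s i≤j))

opposite-reverses-< : ∀ {n} {i j : Fin n} → i <ᶠ j → opposite j <ᶠ opposite i
opposite-reverses-< {n} {i} {j} i<j = subst₂ _<_ (sym (opposite-prop j)) (sym (opposite-prop i))
  (∸-monoʳ-< (s≤s i<j) (toℕ<n j))

-- Block structures

patterns : ℕ → ℕ → ℕ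
patterns t σ = (2 ^ σ) ^ t

frontSize : ℕ → ℕ → ℕ
frontSize t X = suc (patterns t (2 * X) * X)

pigeonhole-patterns : ∀ t σ → Pigeonhole (patterns t σ) (Pointwise (Pointwise (_≡_ {A = Bool}) {σ}) {t})
pigeonhole-patterns t σ =
  pigeonhole-Pointwise {R = Pointwise _≡_} (pigeonhole-Pointwise {R = _≡_} pigeonhole-Bool σ) t

requiredTail : ℕ → ℕ → ℕ → ℕ
requiredTail t X M = frontSize t X + patterns t (2 * X) * frontSize t X ^ X * M

blockSize : ℕ → ℕ → ℕ
blockSize n zero    = n
blockSize n (suc r) = 2 * blockSize n r

tailSize : ℕ → ℕ → ℕ → ℕ
tailSize n t zero    = n
tailSize n t (suc r) = requiredTail t (blockSize n r) (tailSize n (suc t) r)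

tailSize-positive : ∀ {n} → 0 < n → ∀ t r → 0 < tailSize n t r
tailSize-positive 0<n t zero    = 0<n
tailSize-positive 0<n t (suc r) = s≤s z≤n

module Blocks {N} (c : Colouring3 N) where

  -- Blocks are numbered from right to left: block zero is adjacent to the tail, and
  -- colour i j (meaningful only for j < i) is the colour of every triple whose two
  -- leftmost vertices lie in blocks i and j.
  record BlockStructure (t σ M : ℕ) : Set where
    field
      block        : Fin t → Fin σ → Fin N
      tail         : Fin M → Fin N
      colour       : Fin t → Fin t → Bool
      block-inc    : ∀ i → StrictlyIncreasing (block i)
      tail-inc     : StrictlyIncreasing tail
      block<block  : ∀ {i j} → j <ᶠ i → ∀ p q → block i p <ᶠ block j q
      block<tail   : ∀ i p q → block i p <ᶠ tail q
      colour-block : ∀ {i j k} → j <ᶠ i → k <ᶠ j → ∀ p q r →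
                     c (block i p) (block j q) (block k r) ≡ colour i j
      colour-tail  : ∀ {i j} → j <ᶠ i → ∀ p q r → c (block i p) (block j q) (tail r) ≡ colour i j

  module Extension {t X M} (0<M : 0 < M) (B : BlockStructure t (2 * X) (requiredTail t X M)) where
    open BlockStructure B

    L M₀ : ℕ
    L = frontSize t X
    M₀ = patterns t (2 * X) * L ^ X * M

    W : Fin L → Fin N
    W y = tail (y ↑ˡ M₀)

    Rest : Fin M₀ → Fin N
    Rest z = tail (L ↑ʳ z)

    W-inc : StrictlyIncreasing W
    W-inc i j = tail-inc _ _ ∘ ↑ˡ-strictlyIncreasing M₀ i j

    Rest-inc : StrictlyIncreasing Rest
    Rest-inc i j = tail-inc _ _ ∘ ↑ʳ-strictlyIncreasing L i j

    W<Rest : ∀ y z → W y <ᶠ Rest z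
    W<Rest y z = tail-inc _ _ (↑ˡ<↑ʳ y z)

    profile : Fin M₀ → Fin L → Fin t → Fin (2 * X) → Bool
    profile z y i p = c (block i p) (W y) (Rest z)

    rectangle : ConstantRectangle (Pointwise (Pointwise _≡_)) X M profile
    rectangle = bipartite-pigeonhole {K = patterns t (2 * X)}
      (Pointwise.trans {R = Pointwise _≡_} (Pointwise.trans {R = _≡_} trans)) (pigeonhole-patterns t (2 * X))
      X (patterns t (2 * X) * X) M 0<M (n≤1+n _) profile
    open ConstantRectangle rectangle

    halve : ∀ i → ∃[ b ] Selection X (λ p → value i p ≡ b)
    halve i = pigeonhole-Bool X (2 * X) ≤-refl (value i)

    newColour : Fin t → Bool
    newColour i = proj₁ (halve i)
    S : Fin t → Fin X → Fin (2 * X)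
    S i = proj₁ (proj₂ (halve i))

    block′ : Fin (suc t) → Fin X → Fin N
    block′ zero    = W ∘ front
    block′ (suc i) = block i ∘ S i

    colour′ : Fin (suc t) → Fin (suc t) → Bool
    colour′ (suc i) zero    = newColour i
    colour′ (suc i) (suc j) = colour i j
    colour′ zero    _       = false   -- block zero is never the leftmost of two blocks

    block-inc′ : ∀ i → StrictlyIncreasing (block′ i)
    block-inc′ zero    = strictlyIncreasing-∘ W-inc front-inc
    block-inc′ (suc i) = strictlyIncreasing-∘ (block-inc i) (proj₁ (proj₂ (proj₂ (halve i))))

    block<block′ : ∀ {i j} → j <ᶠ i → ∀ p q → block′ i p <ᶠ block′ j q
    block<block′ {suc i} {zero}  _         p q = block<tail i _ _
    block<block′ {suc i} {suc j} (s≤s j<i) p q = block<block j<i _ _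

    block<tail′ : ∀ i p q → block′ i p <ᶠ Rest (back q)
    block<tail′ zero    p q = W<Rest _ _
    block<tail′ (suc i) p q = block<tail i _ _

    colour-block′ : ∀ {i j k} → j <ᶠ i → k <ᶠ j → ∀ p q r →
                    c (block′ i p) (block′ j q) (block′ k r) ≡ colour′ i j
    colour-block′ {suc i} {suc j} {zero}  (s≤s j<i) _         p q r = colour-tail j<i _ _ _
    colour-block′ {suc i} {suc j} {suc k} (s≤s j<i) (s≤s k<j) p q r = colour-block j<i k<j _ _ _

    colour-tail′ : ∀ {i j} → j <ᶠ i → ∀ p q r → c (block′ i p) (block′ j q) (Rest (back r)) ≡ colour′ i j
    colour-tail′ {suc i} {zero}  _         p q r =
      trans (constant r q i (S i p)) (proj₂ (proj₂ (proj₂ (halve i))) p)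
    colour-tail′ {suc i} {suc j} (s≤s j<i) p q r = colour-tail j<i _ _ _

    extended : BlockStructure (suc t) X M
    extended = record
      { block = block′ ; tail = Rest ∘ back ; colour = colour′ ; block-inc = block-inc′
      ; tail-inc = strictlyIncreasing-∘ Rest-inc back-inc
      ; block<block = block<block′ ; block<tail = block<tail′
      ; colour-block = colour-block′ ; colour-tail = colour-tail′ }

  extend : ∀ {t X M} → 0 < M → BlockStructure t (2 * X) (requiredTail t X M) → BlockStructure (suc t) X M
  extend = Extension.extended

  initial : ∀ {σ} → BlockStructure 0 σ N
  initial = record
    { block = λ () ; tail = λ z → z ; colour = λ () ; block-inc = λ () ; tail-inc = λ _ _ h → h
    ; block<block = λ { {()} } ; block<tail = λ () ; colour-block = λ { {()} }
    ; colour-tail = λ { {()} } }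

  iterate : ∀ {n} → 0 < n → ∀ r t → BlockStructure t (blockSize n r) (tailSize n t r) →
            BlockStructure (r + t) n n
  iterate 0<n zero    t B = B
  iterate {n} 0<n (suc r) t B = subst (λ u → BlockStructure u n n) (+-suc r t)
    (iterate 0<n r (suc t) (extend (tailSize-positive 0<n (suc t) r) B))

  module MonochromaticCopy {t n k} (B : BlockStructure t n n) (ramsey : GraphArrows t k) where
    open BlockStructure B

    homogeneous : Σ (Fin k → Fin t) λ h → StrictlyIncreasing h × ∃[ b ] (∀ x y → x <ᶠ y → colour (h y) (h x) ≡ b)
    homogeneous = ramsey (λ x y → colour y x)
    h : Fin k → Fin t
    h = proj₁ homogeneous
    h-inc : StrictlyIncreasing h
    h-inc = proj₁ (proj₂ homogeneous)
    β : Bool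
    β = proj₁ (proj₂ (proj₂ homogeneous))
    h-colour : ∀ {a b} → b <ᶠ a → colour (h a) (h b) ≡ β
    h-colour b<a = proj₂ (proj₂ (proj₂ homogeneous)) _ _ b<a

    -- Interval a of H is sent to part opposite a: intervals are numbered from the left,
    -- parts (the tail zero, then the chosen blocks) from the right.
    place : Fin (suc k) → Fin n → Fin N
    place zero    = tail
    place (suc a) = block (h a)

    place-inc : ∀ a → StrictlyIncreasing (place a)
    place-inc zero    = tail-inc
    place-inc (suc a) = block-inc (h a)

    place-< : ∀ {a b} → b <ᶠ a → ∀ x y → place a x <ᶠ place b y
    place-< {suc a} {zero}  _         x y = block<tail (h a) x y
    place-< {suc a} {suc b} (s≤s b<a) x y = block<block (h-inc b a b<a) x y

    place-colour : ∀ {a b d} → b <ᶠ a → d <ᶠ b → ∀ x y z → c (place a x) (place b y) (place d z) ≡ β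
    place-colour {suc a} {suc b} {zero}  (s≤s b<a) _         x y z =
      trans (colour-tail (h-inc b a b<a) x y z) (h-colour b<a)
    place-colour {suc a} {suc b} {suc d} (s≤s b<a) (s≤s d<b) x y z =
      trans (colour-block (h-inc b a b<a) (h-inc d b d<b) x y z) (h-colour b<a)

    monoCopy : (H : OHG3 n) → IntervalPartition H (suc k) → HasMonoCopy H c
    monoCopy H (g , g-mono , _ , g-edge) = f , f-inc , β , λ i j l i<j j<l e →
      place-colour (opposite-reverses-< (proj₁ (g-edge i j l i<j j<l e)))
                   (opposite-reverses-< (proj₂ (g-edge i j l i<j j<l e))) i j l
      where
      f : Fin n → Fin N
      f v = place (opposite (g v)) v
      f-inc : StrictlyIncreasing f
      f-inc i j i<j with opposite (g j) ≟ᶠ opposite (g i)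
      ... | yes same rewrite same = place-inc (opposite (g i)) i j i<j
      ... | no differ = place-< (≤∧≢⇒<ᶠ (opposite-reverses-≤ (g-mono i j (<⇒≤ i<j))) differ) i j

-- Size bounds

n<2^n : ∀ n → n < 2 ^ n
n<2^n zero    = s≤s z≤n
n<2^n (suc n) = +-mono-≤ (m^n>0 2 n) (≤-trans (n<2^n n) (m≤m+n _ 0))

suc[2^a*x]≤2^[a+x] : ∀ a x → suc (2 ^ a * x) ≤ 2 ^ (a + x)
suc[2^a*x]≤2^[a+x] a x = begin
  suc (2 ^ a * x)    ≤⟨ +-monoˡ-≤ (2 ^ a * x) (m^n>0 2 a) ⟩
  2 ^ a + 2 ^ a * x  ≡⟨ *-suc (2 ^ a) x ⟨
  2 ^ a * suc x      ≤⟨ *-monoʳ-≤ (2 ^ a) (n<2^n x) ⟩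
  2 ^ a * 2 ^ x      ≡⟨ ^-distribˡ-+-* 2 a x ⟨
  2 ^ (a + x)        ∎
  where open ≤-Reasoning

+-≤-2^suc : ∀ {x y} p → x ≤ 2 ^ p → y ≤ 2 ^ p → x + y ≤ 2 ^ suc p
+-≤-2^suc p x≤ y≤ = ≤-trans (+-mono-≤ x≤ y≤) (≤-reflexive (cong (2 ^ p +_) (sym (+-identityʳ (2 ^ p)))))

requiredTail-bound : ∀ t X M → 0 < X → M ≤ 2 ^ (2 * suc (suc t) * (X * X)) →
  requiredTail t X M ≤ 2 ^ (2 * suc t * ((2 * X) * (2 * X)))
requiredTail-bound t X@(suc Y) M (s≤s z≤n) M≤ =
  ≤-trans (+-≤-2^suc P (≤-trans front≤ (^-monoʳ-≤ 2 a+X≤P)) rest≤) (^-monoʳ-≤ 2 P<target)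
  where
  a e P : ℕ
  a = 2 * X * t
  e = 2 * suc (suc t) * (X * X)
  P = a + (a + X) * X + e

  -- With X = 1 + Y both differences below are polynomials in t and Y with nonnegative coefficients.
  P-split : ∀ t Y → let X = suc Y; a = 2 * X * t in
    a + (a + X) * X + 2 * suc (suc t) * (X * X) ≡ (a + X) + ((a + X) * Y + a + 2 * suc (suc t) * (X * X))
  P-split = solve-∀
  target-split : ∀ t Y → let X = suc Y; a = 2 * X * t in
    2 * suc t * ((2 * X) * (2 * X)) ≡
    suc (a + (a + X) * X + 2 * suc (suc t) * (X * X)) + ((4 * t + 3) * (Y * Y) + (6 * t + 6) * Y + 2 * t + 2)
  target-split = solve-∀

  a+X≤P : a + X ≤ P
  a+X≤P = subst (a + X ≤_) (sym (P-split t Y)) (m≤m+n (a + X) _)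
  P<target : P < 2 * suc t * ((2 * X) * (2 * X))
  P<target = subst (suc P ≤_) (sym (target-split t Y)) (m≤m+n (suc P) _)

  patterns≡ : patterns t (2 * X) ≡ 2 ^ a
  patterns≡ = ^-*-assoc 2 (2 * X) t
  front≤ : frontSize t X ≤ 2 ^ (a + X)
  front≤ = subst (λ K → suc (K * X) ≤ 2 ^ (a + X)) (sym patterns≡) (suc[2^a*x]≤2^[a+x] a X)
  rest≤ : patterns t (2 * X) * frontSize t X ^ X * M ≤ 2 ^ P
  rest≤ = begin
    patterns t (2 * X) * frontSize t X ^ X * M
      ≤⟨ *-mono-≤ (*-mono-≤ (≤-reflexive patterns≡) (^-monoˡ-≤ X front≤)) M≤ ⟩
    2 ^ a * (2 ^ (a + X)) ^ X * 2 ^ e  ≡⟨ cong (λ w → 2 ^ a * w * 2 ^ e) (^-*-assoc 2 (a + X) X) ⟩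
    2 ^ a * 2 ^ ((a + X) * X) * 2 ^ e  ≡⟨ cong (_* 2 ^ e) (^-distribˡ-+-* 2 a _) ⟨
    2 ^ (a + (a + X) * X) * 2 ^ e      ≡⟨ ^-distribˡ-+-* 2 (a + (a + X) * X) e ⟨
    2 ^ P                              ∎
    where open ≤-Reasoning

blockSize-positive : ∀ {n} → 0 < n → ∀ r → 0 < blockSize n r
blockSize-positive 0<n zero    = 0<n
blockSize-positive 0<n (suc r) = ≤-trans (blockSize-positive 0<n r) (m≤m+n _ _)

tailSize-bound : ∀ {n} → 0 < n → ∀ t r → tailSize n t r ≤ 2 ^ (2 * suc t * (blockSize n r * blockSize n r))
tailSize-bound {n} (s≤s z≤n) t zero = ≤-trans (<⇒≤ (n<2^n n))
  (^-monoʳ-≤ 2 (≤-trans (m≤m*n n n) (m≤n*m (n * n) (2 * suc t))))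
tailSize-bound 0<n t (suc r) = requiredTail-bound t _ _ (blockSize-positive 0<n r) (tailSize-bound 0<n (suc t) r)

blockSize≡ : ∀ n r → blockSize n r ≡ 2 ^ r * n
blockSize≡ n zero    = sym (+-identityʳ n)
blockSize≡ n (suc r) = trans (cong (2 *_) (blockSize≡ n r)) (sym (*-assoc 2 (2 ^ r) n))

exponent-bound : ∀ {χ} → 2 ≤ χ ^ 2 → ∀ n R →
  2 * 1 * (blockSize n R * blockSize n R) ≤ 2 ^ (2 * R) * (χ ^ 2) * (n ^ 2)
exponent-bound {χ} 2≤χ² n R = begin
  2 * 1 * (blockSize n R * blockSize n R)  ≡⟨ cong (λ B → 2 * 1 * (B * B)) (blockSize≡ n R) ⟩
  2 * 1 * ((2 ^ R * n) * (2 ^ R * n))      ≡⟨ square-out (2 ^ R) n ⟩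
  2 * ((2 ^ R * 2 ^ R) * (n * n))          ≤⟨ *-monoˡ-≤ _ 2≤χ² ⟩
  χ ^ 2 * ((2 ^ R * 2 ^ R) * (n * n))      ≡⟨ reorder (2 ^ R) n χ ⟩
  (2 ^ R * 2 ^ R) * (χ ^ 2) * (n ^ 2)      ≡⟨ cong (λ Q → Q * (χ ^ 2) * (n ^ 2)) 2^[2R]≡2^R*2^R ⟨
  2 ^ (2 * R) * (χ ^ 2) * (n ^ 2)          ∎
  where
  open ≤-Reasoning
  2^[2R]≡2^R*2^R : 2 ^ (2 * R) ≡ 2 ^ R * 2 ^ R
  2^[2R]≡2^R*2^R = trans (^-distribˡ-+-* 2 R (R + 0)) (cong (λ w → 2 ^ R * 2 ^ w) (+-identityʳ R))
  square-out : ∀ P n → 2 * 1 * ((P * n) * (P * n)) ≡ 2 * ((P * P) * (n * n))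
  square-out = solve-∀
  reorder : ∀ P n χ → χ * (χ * 1) * ((P * P) * (n * n)) ≡ (P * P) * (χ * (χ * 1)) * (n * (n * 1))
  reorder = solve-∀

open Blocks using (BlockStructure; iterate; initial; module MonochromaticCopy)

blockStructure : ∀ {n} R → 0 < n → (c : Colouring3 (tailSize n 0 R)) → BlockStructure c R n n
blockStructure {n} R 0<n c =
  subst (λ u → BlockStructure c u n n) (+-identityʳ R) (iterate c 0<n R 0 (initial c))

corollary1 : ∀ (χ n R : ℕ) → 3 ≤ χ → 1 ≤ n → IsRamseyNumber (χ ∸ 1) R →
    (H : OHG3 n) → IntervalChromaticNumber H χ →
    OrdRamseyLE H (2 ^ (2 ^ (2 * R) * (χ ^ 2) * (n ^ 2)))
corollary1 (suc k) n R 3≤χ@(s≤s _) 0<n (ramsey , _) H (partition , _) =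
  tailSize n 0 R ,
  ≤-trans (tailSize-bound 0<n 0 R) (^-monoʳ-≤ 2 (exponent-bound {suc k} 2≤χ² n R)) ,
  λ c → MonochromaticCopy.monoCopy c (blockStructure R 0<n c) ramsey H partition
  where
  2≤χ² : 2 ≤ suc k ^ 2
  2≤χ² = ≤-trans (s≤s (s≤s z≤n)) (^-monoˡ-≤ 2 3≤χ)
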